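{- For every $n\ge 1$, $|\mathcal{RS}_n(231,213)|=F_{n+1}$.
   Context: For $\sigma\in\mathfrak{S}_n$, a double descent is an index $i$ with $\sigma_i>\sigma_{i+1}>\sigma_{i+2}$. The permutation $\sigma$ is simsun if for every $k$, the subword of $\sigma$ consisting of the letters in $\{1,\dots,k\}$ (in the order they appear in $\sigma$) has no double descent. For $\omega\in\mathfrak{S}_t$, $\sigma$ contains an $\omega$-pattern if there are indices $i_1<\cdots<i_t$ with $\sigma_{i_j}<\sigma_{i_k}$ iff $\omega_j<\omega_k$; otherwise $\sigma$ avoids $\omega$. $\mathcal{RS}_n(231,213)$ is the set of simsun permutations in $\mathfrak{S}_n$ avoiding both $231$ and $213$. $F_n$ is the Fibonacci number with $F_1=F_2=1$, $F_n=F_{n-1}+F_{n-2}$. -}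

module Defs where

open import Data.Nat using (ℕ; zero; suc; _+_; _<_; _≤_)
open import Data.List using (List; []; _∷_; filter; length; upTo; map; lookup)
open import Data.List.Relation.Binary.Permutation.Propositional using (_↭_)
open import Data.List.Relation.Binary.Sublist.Propositional using (_⊆_)
open import Data.Fin using (Fin)
open import Data.Product using (_×_; ∃; Σ-syntax)
open import Relation.Binary.PropositionalEquality using (_≡_)
open import Relation.Nullary using (¬_)
open import Data.Nat.Properties using (_≤?_)

-- Fibonacci with F 1 = F 2 = 1 (and F 0 = 0)
fib : ℕ → ℕ
fib zero = zero
fib (suc zero) = suc zero
fib (suc (suc n)) = fib (suc n) + fib n

oneTo : ℕ → List ℕ
oneTo n = map suc (upTo n)

-- a permutation in S_n, in one-line notation σ₁ … σₙ
IsPerm : ℕ → List ℕ → Set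
IsPerm n σ = σ ↭ oneTo n

data HasDoubleDescent : List ℕ → Set where
  here  : ∀ {a b c xs} → b < a → c < b → HasDoubleDescent (a ∷ b ∷ c ∷ xs)
  there : ∀ {x xs} → HasDoubleDescent xs → HasDoubleDescent (x ∷ xs)

restrict : ℕ → List ℕ → List ℕ
restrict k σ = filter (_≤? k) σ

Simsun : List ℕ → Set
Simsun σ = ∀ k → ¬ HasDoubleDescent (restrict k σ)

OrderIso : List ℕ → List ℕ → Set
OrderIso u w = Σ[ eq ∈ length u ≡ length w ]
  (∀ (j k : Fin (length u)) →
     (lookup u j < lookup u k → lookup w (castF eq j) < lookup w (castF eq k)) ×
     (lookup w (castF eq j) < lookup w (castF eq k) → lookup u j < lookup u k))
  where
  castF : ∀ {m n} → m ≡ n → Fin m → Fin n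
  castF _≡_.refl i = i

Contains : List ℕ → List ℕ → Set
Contains ω σ = ∃ λ τ → τ ⊆ σ × OrderIso τ ω

Avoids : List ℕ → List ℕ → Set
Avoids ω σ = ¬ Contains ω σ

InRS231-213 : ℕ → List ℕ → Set
InRS231-213 n σ = IsPerm n σ × Simsun σ
                  × Avoids (2 ∷ 3 ∷ 1 ∷ []) σ × Avoids (2 ∷ 1 ∷ 3 ∷ []) σ

module Submission where

-- Work with permutations of an arbitrary interval [lo, lo+m) (`range lo m`).
-- If a permutation avoids 231 and 213, its first letter is the minimum or the
-- maximum of the interval: otherwise both extremes follow it and form one of
-- the two patterns with it.  For simsun permutations, a leading maximum must
-- be followed by the minimum of the rest: a second maximum followed by any
-- further letter is a double descent.  Conversely, prepending the minimum, or
-- the maximum followed by the minimum, preserves simsun-ness and both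
-- avoidances.  Hence the admissible permutations of [lo, lo+m+2) are exactly
--   lo ∷ (admissible on [lo+1, lo+m+2))   and   (lo+m+1) ∷ lo ∷ (admissible on [lo+1, lo+m+1)),
-- which is the Fibonacci recurrence.  The file first develops the interval,
-- simsun and pattern facts, then defines the enumeration `perms`, counts it,
-- shows it is duplicate-free, proves it is sound and complete, and finally
-- specialises to the interval [1, n].

open import Defs
open import Data.Nat using (ℕ; zero; suc; _+_; _≤_; _<_; _≟_; s<s; z<s)
open import Data.Nat.Properties
open import Data.List using (List; []; _∷_; _++_; [_]; length; map; applyUpTo)
open import Data.List.Properties
  using (∷-injectiveˡ; ∷-injectiveʳ; length-++; length-map; map-applyUpTo; filter-all; filter-accept; filter-reject)
open import Data.List.Relation.Unary.All using (All; []; _∷_)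
import Data.List.Relation.Unary.All as All
open import Data.List.Relation.Unary.All.Properties using (filter⁺)
open import Data.List.Relation.Unary.AllPairs using ([]; _∷_)
open import Data.List.Relation.Unary.Any using (here; there)
open import Data.List.Relation.Unary.Unique.Propositional using (Unique)
import Data.List.Relation.Unary.Unique.Propositional.Properties as Unique
open import Data.List.Membership.Propositional using (_∈_)
open import Data.List.Membership.Propositional.Properties using (∈-map⁺; ∈-map⁻; ∈-++⁺ˡ; ∈-++⁺ʳ; ∈-++⁻)
open import Data.List.Relation.Binary.Permutation.Propositional using (_↭_; prep; swap; ↭-refl; ↭-sym; ↭-trans)
open import Data.List.Relation.Binary.Permutation.Propositional.Properties
  using (∈-resp-↭; ↭-length; drop-∷; ↭-empty-inv; ↭-singleton-inv)
open import Data.List.Relation.Binary.Sublist.Propositional using (_⊆_; []; _∷_; _∷ʳ_; from∈)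
open import Data.List.Relation.Binary.Sublist.Propositional.Properties using (Any-resp-⊆)
open import Data.Fin using (zero; suc)
open import Data.Product using (Σ-syntax; _×_; _,_; proj₁; proj₂)
open import Data.Sum using (_⊎_; inj₁; inj₂)
open import Data.Empty using (⊥; ⊥-elim)
open import Function.Bundles using (_⇔_; mk⇔)
open import Relation.Nullary using (¬_; yes; no)
open import Relation.Binary.PropositionalEquality using (_≡_; _≢_; refl; sym; trans; cong; cong₂; subst; module ≡-Reasoning)

-- Intervals [lo, lo+m) as increasing lists.

range : ℕ → ℕ → List ℕ
range lo zero    = []
range lo (suc m) = lo ∷ range (suc lo) m

applyUpTo-range : ∀ (f : ℕ → ℕ) lo m → (∀ i → f i ≡ lo + i) → applyUpTo f m ≡ range lo m
applyUpTo-range f lo zero    f≗ = refl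
applyUpTo-range f lo (suc m) f≗ = cong₂ _∷_ (trans (f≗ 0) (+-identityʳ lo))
  (applyUpTo-range (λ i → f (suc i)) (suc lo) m (λ i → trans (f≗ (suc i)) (+-suc lo i)))

oneTo≡range : ∀ n → oneTo n ≡ range 1 n
oneTo≡range n = trans (map-applyUpTo (λ i → i) suc n) (applyUpTo-range suc 1 n (λ i → refl))

range-bounds : ∀ {lo m y} → y ∈ range lo m → lo ≤ y × y < lo + m
range-bounds {lo} {suc m} (here refl) = ≤-refl , m<m+n lo z<s
range-bounds {lo} {suc m} {y} (there y∈) with range-bounds {suc lo} {m} y∈
... | lo<y , y<end = <⇒≤ lo<y , subst (y <_) (sym (+-suc lo m)) y<end

∈-range : ∀ {lo m y} → lo ≤ y → y < lo + m → y ∈ range lo m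
∈-range {lo} {zero} lo≤y y<lo = ⊥-elim (<-irrefl refl (≤-<-trans lo≤y (subst (_ <_) (+-identityʳ lo) y<lo)))
∈-range {lo} {suc m} {y} lo≤y y<end with lo ≟ y
... | yes refl = here refl
... | no lo≢y  = there (∈-range (≤∧≢⇒< lo≤y lo≢y) (subst (y <_) (+-suc lo m) y<end))

range-max-first : ∀ lo m → range lo (suc m) ↭ (lo + m) ∷ range lo m
range-max-first lo zero    = subst (λ top → lo ∷ [] ↭ top ∷ []) (sym (+-identityʳ lo)) ↭-refl
range-max-first lo (suc m) = ↭-trans (prep lo shifted) (swap lo (lo + suc m) ↭-refl)
  where
  shifted : range (suc lo) (suc m) ↭ (lo + suc m) ∷ range (suc lo) m
  shifted = subst (λ top → range (suc lo) (suc m) ↭ top ∷ range (suc lo) m) (sym (+-suc lo m))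
    (range-max-first (suc lo) m)

range-nonempty : ∀ {lo m} → ¬ ([] ↭ range lo (suc m))
range-nonempty p with ↭-empty-inv (↭-sym p)
... | ()

restrict-all : ∀ {k w} → All (_≤ k) w → restrict k w ≡ w
restrict-all {k} = filter-all (_≤? k)

simsun⇒no-dd : ∀ {k σ} → Simsun σ → All (_≤ k) σ → ¬ HasDoubleDescent σ
simsun⇒no-dd {k} s σ≤k dd = s k (subst HasDoubleDescent (sym (restrict-all σ≤k)) dd)

-- Restrictions of a tail are tails (or equal) to restrictions of the word.
simsun-tail : ∀ {x τ} → Simsun (x ∷ τ) → Simsun τ
simsun-tail {x} {τ} s k dd with x ≤? k
... | yes x≤k = s k (subst HasDoubleDescent (sym (filter-accept (_≤? k) x≤k)) (there dd))
... | no  x≰k = s k (subst HasDoubleDescent (sym (filter-reject (_≤? k) x≰k)) dd)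

-- `DescentBelow x w`: w begins with a descent b > c whose top b is below x, so
-- that x ∷ w begins with the double descent x > b > c.
data DescentBelow (x : ℕ) : List ℕ → Set where
  descent : ∀ {b c w} → b < x → c < b → DescentBelow x (b ∷ c ∷ w)

dd-∷ : ∀ {x w} → HasDoubleDescent (x ∷ w) → HasDoubleDescent w ⊎ DescentBelow x w
dd-∷ (here b<x c<b) = inj₂ (descent b<x c<b)
dd-∷ (there dd)     = inj₁ dd

simsun-∷ : ∀ {x τ} → Simsun τ → (∀ k → x ≤ k → ¬ DescentBelow x (restrict k τ)) → Simsun (x ∷ τ)
simsun-∷ {x} {τ} s fresh k dd with x ≤? k
... | no  x≰k = s k (subst HasDoubleDescent (filter-reject (_≤? k) x≰k) dd)
... | yes x≤k with dd-∷ (subst HasDoubleDescent (filter-accept (_≤? k) x≤k) dd)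
...   | inj₁ dd′ = s k dd′
...   | inj₂ d   = fresh k x≤k d

simsun-∷-min : ∀ {x τ} → All (x <_) τ → Simsun τ → Simsun (x ∷ τ)
simsun-∷-min {x} x<τ s = simsun-∷ s (λ k _ → no-descent (filter⁺ (_≤? k) x<τ))
  where
  no-descent : ∀ {w} → All (x <_) w → ¬ DescentBelow x w
  no-descent (x<b ∷ _) (descent b<x _) = <-asym b<x x<b

simsun-∷-max-min : ∀ {x y ρ} → All (_< x) (y ∷ ρ) → All (y <_) ρ → Simsun (y ∷ ρ) → Simsun (x ∷ y ∷ ρ)
simsun-∷-max-min {x} {y} {ρ} below-x y<ρ s = simsun-∷ s fresh
  where
  no-descent : ¬ DescentBelow x (y ∷ ρ)
  no-descent (descent _ c<y) = <-asym c<y (All.head y<ρ)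
  fresh : ∀ k → x ≤ k → ¬ DescentBelow x (restrict k (y ∷ ρ))
  fresh k x≤k d = no-descent (subst (DescentBelow x)
    (restrict-all (All.map (λ z<x → <⇒≤ (<-≤-trans z<x x≤k)) below-x)) d)

ω231 ω213 : List ℕ
ω231 = 2 ∷ 3 ∷ 1 ∷ []
ω213 = 2 ∷ 1 ∷ 3 ∷ []

SameOrder : ℕ → ℕ → ℕ → ℕ → Set
SameOrder a b a′ b′ = (a < b × a′ < b′) ⊎ (b < a × b′ < a′)

triple-iso : ∀ {p q r p′ q′ r′} → SameOrder p q p′ q′ → SameOrder p r p′ r′ → SameOrder q r q′ r′ →
             OrderIso (p ∷ q ∷ r ∷ []) (p′ ∷ q′ ∷ r′ ∷ [])
triple-iso pq pr qr = refl , λ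
  { zero             zero             → diagonal
  ; zero             (suc zero)       → forward pq
  ; zero             (suc (suc zero)) → forward pr
  ; (suc zero)       zero             → backward pq
  ; (suc zero)       (suc zero)       → diagonal
  ; (suc zero)       (suc (suc zero)) → forward qr
  ; (suc (suc zero)) zero             → backward pr
  ; (suc (suc zero)) (suc zero)       → backward qr
  ; (suc (suc zero)) (suc (suc zero)) → diagonal
  }
  where
  Agree : ℕ → ℕ → ℕ → ℕ → Set
  Agree a b a′ b′ = (a < b → a′ < b′) × (a′ < b′ → a < b)
  diagonal : ∀ {a a′} → Agree a a a′ a′
  diagonal = (λ a<a → ⊥-elim (<-irrefl refl a<a)) , (λ a′<a′ → ⊥-elim (<-irrefl refl a′<a′))
  forward : ∀ {a b a′ b′} → SameOrder a b a′ b′ → Agree a b a′ b′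
  forward (inj₁ (a<b , a′<b′)) = (λ _ → a′<b′) , (λ _ → a<b)
  forward (inj₂ (b<a , b′<a′)) = (λ a<b → ⊥-elim (<-asym a<b b<a)) , (λ a′<b′ → ⊥-elim (<-asym a′<b′ b′<a′))
  backward : ∀ {a b a′ b′} → SameOrder a b a′ b′ → Agree b a b′ a′
  backward (inj₁ (a<b , a′<b′)) = forward (inj₂ (a<b , a′<b′))
  backward (inj₂ (b<a , b′<a′)) = forward (inj₁ (b<a , b′<a′))

avoids-[] : ∀ {a ω} → Avoids (a ∷ ω) []
avoids-[] (.[] , [] , () , _)

avoids-tail : ∀ {ω x τ} → Avoids ω (x ∷ τ) → Avoids ω τ
avoids-tail av (t , t⊆τ , iso) = av (t , (_ ∷ʳ t⊆τ) , iso)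

Extremal : ℕ → List ℕ → Set
Extremal x τ = All (x <_) τ ⊎ All (_< x) τ

not-between : ∀ {x τ l h} → Extremal x τ → l ∈ τ → h ∈ τ → l < x → x < h → ⊥
not-between (inj₁ x<τ) l∈τ _   l<x _   = <-asym l<x (All.lookup x<τ l∈τ)
not-between (inj₂ τ<x) _   h∈τ _   x<h = <-asym x<h (All.lookup τ<x h∈τ)

MiddleFirst : ℕ → ℕ → ℕ → Set
MiddleFirst a b c = (b < a × a < c) ⊎ (c < a × a < b)

middle231 : MiddleFirst 2 3 1
middle231 = inj₂ (s<s z<s , s<s (s<s z<s))

middle213 : MiddleFirst 2 1 3
middle213 = inj₁ (s<s z<s , s<s (s<s z<s))

-- Prepending an extremal letter cannot create an occurrence of a middle-first
-- pattern: such an occurrence starting at x puts letters of τ on both sides of x.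
avoids-∷ : ∀ {a b c x τ} → MiddleFirst a b c → Extremal x τ →
           Avoids (a ∷ b ∷ c ∷ []) τ → Avoids (a ∷ b ∷ c ∷ []) (x ∷ τ)
avoids-∷ _ _ av (t , (_ ∷ʳ t⊆τ) , iso) = av (t , t⊆τ , iso)
avoids-∷ _ _ _ ((_ ∷ [])             , (refl ∷ _) , () , _)
avoids-∷ _ _ _ ((_ ∷ _ ∷ [])         , (refl ∷ _) , () , _)
avoids-∷ _ _ _ ((_ ∷ _ ∷ _ ∷ _ ∷ _) , (refl ∷ _) , () , _)
avoids-∷ (inj₁ (b<a , a<c)) e _ ((_ ∷ u ∷ v ∷ []) , (refl ∷ uv⊆τ) , refl , cmp) =
  not-between e (Any-resp-⊆ uv⊆τ (here refl)) (Any-resp-⊆ uv⊆τ (there (here refl)))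
    (proj₂ (cmp (suc zero) zero) b<a) (proj₂ (cmp zero (suc (suc zero))) a<c)
avoids-∷ (inj₂ (c<a , a<b)) e _ ((_ ∷ u ∷ v ∷ []) , (refl ∷ uv⊆τ) , refl , cmp) =
  not-between e (Any-resp-⊆ uv⊆τ (there (here refl))) (Any-resp-⊆ uv⊆τ (here refl))
    (proj₂ (cmp (suc (suc zero)) zero) c<a) (proj₂ (cmp zero (suc zero)) a<b)

pair⊆ : ∀ {a b : ℕ} {τ} → a ∈ τ → b ∈ τ → a ≢ b → (a ∷ b ∷ []) ⊆ τ ⊎ (b ∷ a ∷ []) ⊆ τ
pair⊆ (here refl) (here refl) a≢b = ⊥-elim (a≢b refl)
pair⊆ (here refl) (there b∈) _    = inj₁ (refl ∷ from∈ b∈)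
pair⊆ (there a∈)  (here refl) _   = inj₂ (refl ∷ from∈ a∈)
pair⊆ {τ = y ∷ _} (there a∈) (there b∈) a≢b with pair⊆ a∈ b∈ a≢b
... | inj₁ ab⊆ = inj₁ (y ∷ʳ ab⊆)
... | inj₂ ba⊆ = inj₂ (y ∷ʳ ba⊆)

head-not-between : ∀ {x τ l h} → l ∈ τ → h ∈ τ → l < x → x < h →
                   Avoids ω231 (x ∷ τ) → Avoids ω213 (x ∷ τ) → ⊥
head-not-between l∈τ h∈τ l<x x<h av231 av213 with pair⊆ l∈τ h∈τ (<⇒≢ (<-trans l<x x<h))
... | inj₁ lh⊆τ = av213 (_ , (refl ∷ lh⊆τ) ,
  triple-iso (inj₂ (l<x , s<s z<s)) (inj₁ (x<h , s<s (s<s z<s))) (inj₁ (<-trans l<x x<h , s<s z<s)))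
... | inj₂ hl⊆τ = av231 (_ , (refl ∷ hl⊆τ) ,
  triple-iso (inj₁ (x<h , s<s (s<s z<s))) (inj₂ (l<x , s<s z<s)) (inj₂ (<-trans l<x x<h , s<s z<s)))

AvoidsBoth : List ℕ → Set
AvoidsBoth σ = Avoids ω231 σ × Avoids ω213 σ

avoidsBoth-∷ : ∀ {x τ} → Extremal x τ → AvoidsBoth τ → AvoidsBoth (x ∷ τ)
avoidsBoth-∷ e (av231 , av213) = avoids-∷ middle231 e av231 , avoids-∷ middle213 e av213

Admissible : List ℕ → Set
Admissible σ = Simsun σ × AvoidsBoth σ

RS : ℕ → ℕ → List ℕ → Set
RS lo m σ = σ ↭ range lo m × Admissible σ

RS-1≡InRS : ∀ n σ → RS 1 n σ ≡ InRS231-213 n σ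
RS-1≡InRS n σ = cong (λ w → σ ↭ w × Admissible σ) (sym (oneTo≡range n))

admissible-[] : Admissible []
admissible-[] = (λ _ ()) , avoids-[] , avoids-[]

admissible-tail : ∀ {x τ} → Admissible (x ∷ τ) → Admissible τ
admissible-tail {x} {τ} (s , av231 , av213) = simsun-tail {x} {τ} s , avoids-tail av231 , avoids-tail av213

rs-above : ∀ {lo m σ} → RS lo m σ → All (lo ≤_) σ
rs-above (p , _) = All.tabulate (λ y∈σ → proj₁ (range-bounds (∈-resp-↭ p y∈σ)))

rs-below : ∀ {lo m σ} → RS lo m σ → All (_< lo + m) σ
rs-below (p , _) = All.tabulate (λ y∈σ → proj₂ (range-bounds (∈-resp-↭ p y∈σ)))

rs-tail-min : ∀ {lo m τ} → RS lo (suc m) (lo ∷ τ) → RS (suc lo) m τ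
rs-tail-min (p , adm) = drop-∷ p , admissible-tail adm

rs-tail-max : ∀ {lo m τ} → RS lo (suc m) ((lo + m) ∷ τ) → RS lo m τ
rs-tail-max {lo} {m} (p , adm) = drop-∷ (↭-trans p (range-max-first lo m)) , admissible-tail adm

rs-∷-min : ∀ {lo m τ} → RS (suc lo) m τ → RS lo (suc m) (lo ∷ τ)
rs-∷-min {lo} {m} {τ} rs@(p , s , av) = prep _ p , simsun-∷-min lo<τ s , avoidsBoth-∷ (inj₁ lo<τ) av
  where
  lo<τ : All (lo <_) τ
  lo<τ = rs-above rs

rs-∷-max-min : ∀ {lo m ρ} → RS (suc lo) m ρ → RS lo (suc (suc m)) ((lo + suc m) ∷ lo ∷ ρ)
rs-∷-max-min {lo} {m} {ρ} rsρ with rs-∷-min rsρ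
... | rsτ@(p , s , av) =
  ↭-trans (prep _ p) (↭-sym (range-max-first lo (suc m))) ,
  simsun-∷-max-min τ<hi (rs-above rsρ) s , avoidsBoth-∷ (inj₂ τ<hi) av
  where
  τ<hi : All (_< lo + suc m) (lo ∷ ρ)
  τ<hi = rs-below rsτ

head-min-or-max : ∀ {lo m x τ} → RS lo (suc (suc m)) (x ∷ τ) → x ≡ lo ⊎ x ≡ lo + suc m
head-min-or-max {lo} {m} {x} {τ} (p , _ , av231 , av213) with x ≟ lo | x ≟ lo + suc m
... | yes x≡lo | _        = inj₁ x≡lo
... | no _     | yes x≡hi = inj₂ x≡hi
... | no x≢lo  | no x≢hi  = ⊥-elim (head-not-between lo∈τ hi∈τ lo<x x<hi av231 av213)
  where
  in-tail : ∀ {y} → y ≢ x → lo ≤ y → y < lo + suc (suc m) → y ∈ τ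
  in-tail y≢x lo≤y y<end with ∈-resp-↭ (↭-sym p) (∈-range lo≤y y<end)
  ... | here y≡x  = ⊥-elim (y≢x y≡x)
  ... | there y∈τ = y∈τ
  x-bounds : lo ≤ x × x < lo + suc (suc m)
  x-bounds = range-bounds (∈-resp-↭ p (here refl))
  lo<x : lo < x
  lo<x = ≤∧≢⇒< (proj₁ x-bounds) (λ lo≡x → x≢lo (sym lo≡x))
  x<hi : x < lo + suc m
  x<hi = ≤∧≢⇒< (≤-pred (subst (x <_) (+-suc lo (suc m)) (proj₂ x-bounds))) x≢hi
  lo∈τ : lo ∈ τ
  lo∈τ = in-tail (<⇒≢ lo<x) ≤-refl (m<m+n lo z<s)
  hi∈τ : lo + suc m ∈ τ
  hi∈τ = in-tail (λ hi≡x → <⇒≢ x<hi (sym hi≡x)) (m≤m+n lo (suc m)) (+-monoʳ-< lo (n<1+n (suc m)))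

-- A simsun permutation of [lo, lo+m+3) cannot begin with its two largest
-- letters: with the letter after them they form a double descent.
two-maxima-first : ∀ {lo m τ} → RS lo (suc (suc m)) ((lo + suc m) ∷ τ) →
                   ¬ Simsun ((lo + suc (suc m)) ∷ (lo + suc m) ∷ τ)
two-maxima-first {τ = []} (p , _) _ with ↭-length p
... | ()
two-maxima-first {lo} {m} {z ∷ ρ} rs s = simsun⇒no-dd s bounded (here y<top (All.head z<y))
  where
  top : ℕ
  top = lo + suc (suc m)
  y<top : lo + suc m < top
  y<top = +-monoʳ-< lo (n<1+n (suc m))
  z<y : All (_< lo + suc m) (z ∷ ρ)
  z<y = rs-below (rs-tail-max rs)
  bounded : All (_≤ top) (top ∷ (lo + suc m) ∷ z ∷ ρ)
  bounded = ≤-refl ∷ All.map <⇒≤ (rs-below rs)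

after-max : ∀ {lo m τ} → RS lo (suc m) τ → Simsun ((lo + suc m) ∷ τ) → Σ[ ρ ∈ List ℕ ] τ ≡ lo ∷ ρ
after-max {m = zero} (p , _) _ with ↭-singleton-inv p
... | refl = [] , refl
after-max {m = suc m} {τ = []} (p , _) _ = ⊥-elim (range-nonempty p)
after-max {m = suc m} {τ = y ∷ ρ} rs s with head-min-or-max rs
... | inj₁ refl = ρ , refl
... | inj₂ refl = ⊥-elim (two-maxima-first rs s)

max-min : ℕ → ℕ → List ℕ → List ℕ
max-min lo m ρ = (lo + suc m) ∷ lo ∷ ρ

perms : ℕ → ℕ → List (List ℕ)
perms lo zero          = [ [] ]
perms lo (suc zero)    = [ [ lo ] ]
perms lo (suc (suc m)) =
  map (lo ∷_) (perms (suc lo) (suc m)) ++ map (max-min lo m) (perms (suc lo) m)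

length-perms : ∀ m lo → length (perms lo m) ≡ fib (suc m)
length-perms zero          lo = refl
length-perms (suc zero)    lo = refl
length-perms (suc (suc m)) lo = begin
  length (map (lo ∷_) (perms (suc lo) (suc m)) ++ map (max-min lo m) (perms (suc lo) m))
    ≡⟨ length-++ (map (lo ∷_) (perms (suc lo) (suc m))) ⟩
  length (map (lo ∷_) (perms (suc lo) (suc m))) + length (map (max-min lo m) (perms (suc lo) m))
    ≡⟨ cong₂ _+_ (length-map (lo ∷_) (perms (suc lo) (suc m))) (length-map (max-min lo m) (perms (suc lo) m)) ⟩
  length (perms (suc lo) (suc m)) + length (perms (suc lo) m)
    ≡⟨ cong₂ _+_ (length-perms (suc m) (suc lo)) (length-perms m (suc lo)) ⟩
  fib (suc (suc m)) + fib (suc m)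
    ∎
  where open ≡-Reasoning

perms-unique : ∀ m lo → Unique (perms lo m)
perms-unique zero          lo = [] ∷ []
perms-unique (suc zero)    lo = [] ∷ []
perms-unique (suc (suc m)) lo = Unique.++⁺
  (Unique.map⁺ ∷-injectiveʳ (perms-unique (suc m) (suc lo)))
  (Unique.map⁺ (λ eq → ∷-injectiveʳ (∷-injectiveʳ eq)) (perms-unique m (suc lo)))
  different-heads
  where
  different-heads : ∀ {σ} → ¬ (σ ∈ map (lo ∷_) (perms (suc lo) (suc m))
                               × σ ∈ map (max-min lo m) (perms (suc lo) m))
  different-heads (σ∈₁ , σ∈₂) with ∈-map⁻ (lo ∷_) σ∈₁ | ∈-map⁻ (max-min lo m) σ∈₂
  ... | _ , _ , refl | _ , _ , eq = <⇒≢ (m<m+n lo z<s) (∷-injectiveˡ eq)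

sound : ∀ m lo σ → σ ∈ perms lo m → RS lo m σ
sound zero          lo .[]         (here refl) = ↭-refl , admissible-[]
sound (suc zero)    lo .(lo ∷ []) (here refl) = rs-∷-min (sound zero (suc lo) [] (here refl))
sound (suc (suc m)) lo σ σ∈ with ∈-++⁻ (map (lo ∷_) (perms (suc lo) (suc m))) σ∈
... | inj₁ σ∈min with ∈-map⁻ (lo ∷_) σ∈min
...   | τ , τ∈ , refl = rs-∷-min (sound (suc m) (suc lo) τ τ∈)
sound (suc (suc m)) lo σ σ∈ | inj₂ σ∈max with ∈-map⁻ (max-min lo m) σ∈max
...   | ρ , ρ∈ , refl = rs-∷-max-min (sound m (suc lo) ρ ρ∈)

complete : ∀ m lo σ → RS lo m σ → σ ∈ perms lo m
complete zero lo σ (p , _) with ↭-empty-inv p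
... | refl = here refl
complete (suc zero) lo σ (p , _) with ↭-singleton-inv p
... | refl = here refl
complete (suc (suc m)) lo [] (p , _) = ⊥-elim (range-nonempty p)
complete (suc (suc m)) lo (x ∷ τ) rs with head-min-or-max rs
... | inj₁ refl = ∈-++⁺ˡ (∈-map⁺ (lo ∷_) (complete (suc m) (suc lo) τ (rs-tail-min rs)))
... | inj₂ refl with after-max (rs-tail-max rs) (proj₁ (proj₂ rs))
...   | ρ , refl = ∈-++⁺ʳ (map (lo ∷_) (perms (suc lo) (suc m)))
  (∈-map⁺ (max-min lo m) (complete m (suc lo) ρ (rs-tail-min (rs-tail-max rs))))

perms-spec : ∀ m lo σ → (σ ∈ perms lo m) ⇔ RS lo m σ
perms-spec m lo σ = mk⇔ (sound m lo σ) (complete m lo σ)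

-- Theorem 3.10.
theorem3p10 : (n : ℕ) → 1 ≤ n →
    Σ[ L ∈ List (List ℕ) ] (Unique L × (∀ σ → (σ ∈ L) ⇔ InRS231-213 n σ) × length L ≡ fib (suc n))
theorem3p10 n _ =
  perms 1 n , perms-unique n 1 ,
  (λ σ → subst ((σ ∈ perms 1 n) ⇔_) (RS-1≡InRS n σ) (perms-spec n 1 σ)) ,
  length-perms n 1
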